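{- Let $m$ be a positive even integer. Let $A, B\subseteq \mathbb{Z}_{m}$ with $A\cup B=\mathbb{Z}_{m}$ and $|A\cap B|=2$. If $R_{A}(\overline{n})=R_{B}(\overline{n})$ for all $\overline{n}\in \mathbb{Z}_{m}$, then $|A|=|B|=\frac{m}{2}+1$.
   Context: $\mathbb{Z}_{m}$ is the set of residue classes modulo $m$. For $\overline{a},\overline{b}\in\mathbb{Z}_m$, write $\overline{a}\leq\overline{b}$ if $a'\le b'$, where $a',b'\in\{0,1,\dots,m-1\}$ are the representatives of $\overline{a},\overline{b}$. For $A\subseteq\mathbb{Z}_m$ and $\overline{n}\in\mathbb{Z}_m$, $R_A(\overline{n})$ denotes the number of solutions of $\overline{n}=\overline{a}+\overline{a'}$ with $\overline{a}\leq\overline{a'}$ and $\overline{a},\overline{a'}\in A$. -}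

module Defs where

open import Data.Nat using (ℕ; _+_; _%_; NonZero)
open import Data.Nat.Properties using (_≟_)
open import Data.Fin using (Fin; toℕ; _≤_; _≤?_)
open import Data.Fin.Subset using (Subset; _∈_)
open import Data.Fin.Subset.Properties using (_∈?_)
open import Data.List using (List; length; filter; allFin; concatMap; map)
open import Data.Product using (_×_; _,_; proj₁; proj₂)
open import Relation.Binary.PropositionalEquality using (_≡_)
open import Relation.Nullary using (Dec; _×-dec_)

_⊕_ : ∀ {m} .{{_ : NonZero m}} → Fin m → Fin m → ℕ
_⊕_ {m} a b = (toℕ a + toℕ b) % m

allPairs : ∀ m → List (Fin m × Fin m)
allPairs m = concatMap (λ a → map (λ b → (a , b)) (allFin m)) (allFin m)

isRep : ∀ {m} .{{_ : NonZero m}} → Subset m → Fin m → Fin m × Fin m → Set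
isRep A n (a , a') = (a ≤ a') × ((a ∈ A) × ((a' ∈ A) × (a ⊕ a' ≡ toℕ n)))

isRep? : ∀ {m} .{{_ : NonZero m}} (A : Subset m) (n : Fin m) (p : Fin m × Fin m) → Dec (isRep A n p)
isRep? A n (a , a') = (a ≤? a') ×-dec ((a ∈? A) ×-dec ((a' ∈? A) ×-dec ((a ⊕ a') ≟ toℕ n)))

R : ∀ {m} .{{_ : NonZero m}} → Subset m → Fin m → ℕ
R {m} A n = length (filter (isRep? A n) (allPairs m))

{-# OPTIONS --safe #-}
-- Every pair a ≤ a' of elements of A represents exactly one residue, so summing R_A over
-- ℤ_m counts the pairs a ≤ a' in A, which is |A|(|A|+1)/2. Hence R_A = R_B forces |A| = |B|,
-- and inclusion–exclusion gives |A| + |B| = |A ∪ B| + |A ∩ B| = m + 2.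
module Submission where

open import Defs
open import Data.Bool using (true; false; if_then_else_)
open import Data.Fin using (Fin; zero; suc; toℕ; _≤?_)
open import Data.Fin.Subset using (Subset; _∪_; _∩_; ∣_∣; ⊤; inside; outside)
open import Data.Fin.Subset.Properties using (_∈?_; ∣⊤∣≡n)
open import Data.List using (List; _++_; length; filter; concat; map; tabulate; allFin)
open import Data.List.Properties using (filter-++; length-++; map-tabulate)
open import Data.Nat using (ℕ; zero; suc; _+_; _*_; _<_; NonZero; s≤s; s≤s⁻¹)
open import Data.Nat.DivMod using (m%n<n)
open import Data.Nat.Properties
  using (+-*-semiring; _≟_; +-suc; +-identityʳ; *-identityˡ; *-identityʳ; *-distribˡ-+;
         *-cancelˡ-≡; suc-injective; <-cmp; <⇒≢; *-mono-<)
open import Data.Nat.Tactic.RingSolver using (solve-∀)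
open import Data.Product using (_×_; _,_)
open import Data.Vec using ([]; _∷_)
open import Function using (_∘_; id)
open import Level using (Level)
open import Relation.Binary using (tri<; tri≈; tri>)
open import Relation.Binary.PropositionalEquality
open import Relation.Nullary using (Dec; yes; no; does; _because_; _×-dec_; ¬_; contradiction)
open import Relation.Nullary.Decidable using (dec-true; dec-false)
open import Relation.Unary using (Pred; Decidable)

open import Algebra.Properties.Semiring.Sum +-*-semiring
  using (sum-syntax; sum-cong-≗; sum-replicate-zero; ∑-comm; *-distribˡ-sum)

private
  variable
    a p q : Level
    P Q : Set p
    X : Set a
    n : ℕ

𝟙 : Dec P → ℕ
𝟙 P? = if does P? then 1 else 0

𝟙-yes : (P? : Dec P) → P → 𝟙 P? ≡ 1
𝟙-yes P? x = cong (if_then 1 else 0) (dec-true P? x)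

𝟙-no : (P? : Dec P) → ¬ P → 𝟙 P? ≡ 0
𝟙-no P? ¬x = cong (if_then 1 else 0) (dec-false P? ¬x)

𝟙-⇔ : (P? : Dec P) (Q? : Dec Q) → (P → Q) → (Q → P) → 𝟙 P? ≡ 𝟙 Q?
𝟙-⇔ P? (yes y) P→Q Q→P = 𝟙-yes P? (Q→P y)
𝟙-⇔ P? (no ¬y) P→Q Q→P = 𝟙-no P? (¬y ∘ P→Q)

𝟙-×-dec : (P? : Dec P) (Q? : Dec Q) → 𝟙 (P? ×-dec Q?) ≡ 𝟙 P? * 𝟙 Q?
𝟙-×-dec (true  because _) Q? = sym (*-identityˡ (𝟙 Q?))
𝟙-×-dec (false because _) Q? = refl

length-filter-tabulate : {P : Pred X p} (P? : Decidable P) (f : Fin n → X) →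
                         length (filter P? (tabulate f)) ≡ ∑[ i < n ] 𝟙 (P? (f i))
length-filter-tabulate {n = zero}  P? f = refl
length-filter-tabulate {n = suc n} P? f with does (P? (f zero))
... | true  = cong suc (length-filter-tabulate P? (f ∘ suc))
... | false = length-filter-tabulate P? (f ∘ suc)

length-filter-concat-tabulate : {P : Pred X p} (P? : Decidable P) (f : Fin n → List X) →
                                length (filter P? (concat (tabulate f))) ≡ ∑[ i < n ] length (filter P? (f i))
length-filter-concat-tabulate {n = zero}  P? f = refl
length-filter-concat-tabulate {n = suc n} P? f = begin
  length (filter P? (f zero ++ rest))             ≡⟨ cong length (filter-++ P? (f zero) rest) ⟩
  length (filter P? (f zero) ++ filter P? rest)   ≡⟨ length-++ (filter P? (f zero)) ⟩
  length (filter P? (f zero)) + length (filter P? rest)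
    ≡⟨ cong (length (filter P? (f zero)) +_) (length-filter-concat-tabulate P? (f ∘ suc)) ⟩
  ∑[ i < suc n ] length (filter P? (f i))         ∎
  where
  open ≡-Reasoning
  rest = concat (tabulate (f ∘ suc))

length-filter-allPairs : {P : Pred (Fin n × Fin n) p} (P? : Decidable P) →
                         length (filter P? (allPairs n)) ≡ ∑[ a < n ] ∑[ b < n ] 𝟙 (P? (a , b))
length-filter-allPairs {n = n} P? = begin
  length (filter P? (concat (map row (tabulate id))))  ≡⟨ cong (length ∘ filter P? ∘ concat) (map-tabulate id row) ⟩
  length (filter P? (concat (tabulate row)))           ≡⟨ length-filter-concat-tabulate P? row ⟩
  ∑[ a < n ] length (filter P? (row a))                ≡⟨ sum-cong-≗ {n} count-row ⟩
  ∑[ a < n ] ∑[ b < n ] 𝟙 (P? (a , b))                 ∎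
  where
  open ≡-Reasoning
  row : Fin n → List (Fin n × Fin n)
  row a = map (a ,_) (allFin n)
  count-row : ∀ a → length (filter P? (row a)) ≡ ∑[ b < n ] 𝟙 (P? (a , b))
  count-row a = trans (cong (length ∘ filter P?) (map-tabulate id (a ,_))) (length-filter-tabulate P? (a ,_))

∑-𝟙-≟-toℕ : ∀ {s} → s < n → ∑[ i < n ] 𝟙 (s ≟ toℕ i) ≡ 1
∑-𝟙-≟-toℕ {n = suc n} {zero} _ =
  cong suc (trans (sum-cong-≗ {n} (λ i → 𝟙-no (0 ≟ suc (toℕ i)) λ ())) (sum-replicate-zero n))
∑-𝟙-≟-toℕ {n = suc n} {suc s} (s≤s s<n) = begin
  𝟙 (suc s ≟ 0) + ∑[ i < n ] 𝟙 (suc s ≟ suc (toℕ i))  ≡⟨ cong₂ _+_ (𝟙-no (suc s ≟ 0) λ ()) (sum-cong-≗ {n} drop-suc) ⟩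
  ∑[ i < n ] 𝟙 (s ≟ toℕ i)                            ≡⟨ ∑-𝟙-≟-toℕ s<n ⟩
  1                                                   ∎
  where
  open ≡-Reasoning
  drop-suc : ∀ i → 𝟙 (suc s ≟ suc (toℕ i)) ≡ 𝟙 (s ≟ toℕ i)
  drop-suc i = 𝟙-⇔ (suc s ≟ suc (toℕ i)) (s ≟ toℕ i) suc-injective (cong suc)

pairCount : Subset n → ℕ
pairCount {n} A = ∑[ a < n ] ∑[ b < n ] (𝟙 (a ≤? b) * (𝟙 (a ∈? A) * 𝟙 (b ∈? A)))

module _ {m : ℕ} .{{_ : NonZero m}} (A : Subset m) where

  ∑-𝟙-isRep : ∀ a b → ∑[ n < m ] 𝟙 (isRep? A n (a , b)) ≡ 𝟙 (a ≤? b) * (𝟙 (a ∈? A) * 𝟙 (b ∈? A))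
  ∑-𝟙-isRep a b = begin
    ∑[ n < m ] 𝟙 (isRep? A n (a , b))   ≡⟨ sum-cong-≗ {m} factor ⟩
    ∑[ n < m ] (c * 𝟙 (a ⊕ b ≟ toℕ n))  ≡⟨ *-distribˡ-sum {m} c (λ n → 𝟙 (a ⊕ b ≟ toℕ n)) ⟨
    c * ∑[ n < m ] 𝟙 (a ⊕ b ≟ toℕ n)    ≡⟨ cong (c *_) (∑-𝟙-≟-toℕ (m%n<n (toℕ a + toℕ b) m)) ⟩
    c * 1                               ≡⟨ *-identityʳ c ⟩
    c                                   ∎
    where
    open ≡-Reasoning
    c = 𝟙 (a ≤? b) * (𝟙 (a ∈? A) * 𝟙 (b ∈? A))
    reassoc : ∀ x y z w → x * (y * (z * w)) ≡ x * (y * z) * w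
    reassoc = solve-∀
    factor : ∀ n → 𝟙 (isRep? A n (a , b)) ≡ c * 𝟙 (a ⊕ b ≟ toℕ n)
    factor n
      rewrite 𝟙-×-dec (a ≤? b) ((a ∈? A) ×-dec ((b ∈? A) ×-dec (a ⊕ b ≟ toℕ n)))
            | 𝟙-×-dec (a ∈? A) ((b ∈? A) ×-dec (a ⊕ b ≟ toℕ n))
            | 𝟙-×-dec (b ∈? A) (a ⊕ b ≟ toℕ n)
            = reassoc (𝟙 (a ≤? b)) (𝟙 (a ∈? A)) (𝟙 (b ∈? A)) (𝟙 (a ⊕ b ≟ toℕ n))

  ∑-R≡pairCount : ∑[ n < m ] R A n ≡ pairCount A
  ∑-R≡pairCount = begin
    ∑[ n < m ] R A n                                          ≡⟨ sum-cong-≗ {m} (λ n → length-filter-allPairs (isRep? A n)) ⟩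
    ∑[ n < m ] ∑[ a < m ] ∑[ b < m ] 𝟙 (isRep? A n (a , b))  ≡⟨ ∑-comm {m} {m} (λ n a → ∑[ b < m ] 𝟙 (isRep? A n (a , b))) ⟩
    ∑[ a < m ] ∑[ n < m ] ∑[ b < m ] 𝟙 (isRep? A n (a , b))  ≡⟨ sum-cong-≗ {m} (λ a → ∑-comm {m} {m} (λ n b → 𝟙 (isRep? A n (a , b)))) ⟩
    ∑[ a < m ] ∑[ b < m ] ∑[ n < m ] 𝟙 (isRep? A n (a , b))  ≡⟨ sum-cong-≗ {m} (λ a → sum-cong-≗ {m} (∑-𝟙-isRep a)) ⟩
    pairCount A                                               ∎
    where open ≡-Reasoning

∣∣≡∑-𝟙-∈ : (A : Subset n) → ∣ A ∣ ≡ ∑[ i < n ] 𝟙 (i ∈? A)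
∣∣≡∑-𝟙-∈ []            = refl
∣∣≡∑-𝟙-∈ (inside  ∷ A) = cong suc (∣∣≡∑-𝟙-∈ A)
∣∣≡∑-𝟙-∈ (outside ∷ A) = ∣∣≡∑-𝟙-∈ A

pairCount-∷ : ∀ x (A : Subset n) → pairCount (x ∷ A) ≡ 𝟙 (zero ∈? x ∷ A) * ∣ x ∷ A ∣ + pairCount A
pairCount-∷ {n} x A = cong₂ _+_ first-row (sum-cong-≗ {n} later-row)
  where
  open ≡-Reasoning
  c = 𝟙 (zero ∈? x ∷ A)
  first-row : ∑[ b < suc n ] (𝟙 (zero {n} ≤? b) * (c * 𝟙 (b ∈? x ∷ A))) ≡ c * ∣ x ∷ A ∣
  first-row = begin
    ∑[ b < suc n ] (1 * (c * 𝟙 (b ∈? x ∷ A)))  ≡⟨ sum-cong-≗ {suc n} (λ b → *-identityˡ (c * 𝟙 (b ∈? x ∷ A))) ⟩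
    ∑[ b < suc n ] (c * 𝟙 (b ∈? x ∷ A))        ≡⟨ *-distribˡ-sum {suc n} c (λ b → 𝟙 (b ∈? x ∷ A)) ⟨
    c * ∑[ b < suc n ] 𝟙 (b ∈? x ∷ A)          ≡⟨ cong (c *_) (∣∣≡∑-𝟙-∈ (x ∷ A)) ⟨
    c * ∣ x ∷ A ∣                               ∎
  later-row : ∀ a → ∑[ b < suc n ] (𝟙 (suc a ≤? b) * (𝟙 (a ∈? A) * 𝟙 (b ∈? x ∷ A)))
                  ≡ ∑[ b < n ] (𝟙 (a ≤? b) * (𝟙 (a ∈? A) * 𝟙 (b ∈? A)))
  later-row a = cong₂ _+_
    (cong (_* (𝟙 (a ∈? A) * c)) (𝟙-no (suc a ≤? zero {n}) λ ()))
    (sum-cong-≗ {n} λ b → cong (_* (𝟙 (a ∈? A) * 𝟙 (b ∈? A))) (𝟙-⇔ (suc a ≤? suc b) (a ≤? b) s≤s⁻¹ s≤s))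

pairCount-triangular : (A : Subset n) → 2 * pairCount A ≡ ∣ A ∣ * suc ∣ A ∣
pairCount-triangular []            = refl
pairCount-triangular (outside ∷ A) = trans (cong (2 *_) (pairCount-∷ outside A)) (pairCount-triangular A)
pairCount-triangular (inside  ∷ A) = begin
  2 * pairCount (inside ∷ A)          ≡⟨ cong (2 *_) (pairCount-∷ inside A) ⟩
  2 * (1 * suc c + pairCount A)       ≡⟨ *-distribˡ-+ 2 (1 * suc c) (pairCount A) ⟩
  2 * (1 * suc c) + 2 * pairCount A   ≡⟨ cong (2 * (1 * suc c) +_) (pairCount-triangular A) ⟩
  2 * (1 * suc c) + c * suc c         ≡⟨ next-triangular c ⟩
  suc c * suc (suc c)                 ∎
  where
  open ≡-Reasoning
  c = ∣ A ∣
  next-triangular : ∀ c → 2 * (1 * suc c) + c * suc c ≡ suc c * suc (suc c)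
  next-triangular = solve-∀

n*[1+n]-injective : ∀ a b → a * suc a ≡ b * suc b → a ≡ b
n*[1+n]-injective a b eq with <-cmp a b
... | tri< a<b _ _ = contradiction eq (<⇒≢ (*-mono-< a<b (s≤s a<b)))
... | tri≈ _ a≡b _ = a≡b
... | tri> _ _ b<a = contradiction (sym eq) (<⇒≢ (*-mono-< b<a (s≤s b<a)))

∣p∪q∣+∣p∩q∣≡∣p∣+∣q∣ : (p q : Subset n) → ∣ p ∪ q ∣ + ∣ p ∩ q ∣ ≡ ∣ p ∣ + ∣ q ∣
∣p∪q∣+∣p∩q∣≡∣p∣+∣q∣ []            []            = refl
∣p∪q∣+∣p∩q∣≡∣p∣+∣q∣ (inside  ∷ p) (inside  ∷ q) = cong suc (begin
  ∣ p ∪ q ∣ + suc ∣ p ∩ q ∣  ≡⟨ +-suc ∣ p ∪ q ∣ ∣ p ∩ q ∣ ⟩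
  suc (∣ p ∪ q ∣ + ∣ p ∩ q ∣) ≡⟨ cong suc (∣p∪q∣+∣p∩q∣≡∣p∣+∣q∣ p q) ⟩
  suc (∣ p ∣ + ∣ q ∣)         ≡⟨ +-suc ∣ p ∣ ∣ q ∣ ⟨
  ∣ p ∣ + suc ∣ q ∣           ∎)
  where open ≡-Reasoning
∣p∪q∣+∣p∩q∣≡∣p∣+∣q∣ (inside  ∷ p) (outside ∷ q) = cong suc (∣p∪q∣+∣p∩q∣≡∣p∣+∣q∣ p q)
∣p∪q∣+∣p∩q∣≡∣p∣+∣q∣ (outside ∷ p) (inside  ∷ q) = trans (cong suc (∣p∪q∣+∣p∩q∣≡∣p∣+∣q∣ p q)) (sym (+-suc ∣ p ∣ ∣ q ∣))
∣p∪q∣+∣p∩q∣≡∣p∣+∣q∣ (outside ∷ p) (outside ∷ q) = ∣p∪q∣+∣p∩q∣≡∣p∣+∣q∣ p q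

R≗R⇒∣∣≡∣∣ : ∀ {m} .{{_ : NonZero m}} (A B : Subset m) → (∀ n → R A n ≡ R B n) → ∣ A ∣ ≡ ∣ B ∣
R≗R⇒∣∣≡∣∣ {m} A B R≗R = n*[1+n]-injective ∣ A ∣ ∣ B ∣ (begin
  ∣ A ∣ * suc ∣ A ∣     ≡⟨ pairCount-triangular A ⟨
  2 * pairCount A       ≡⟨ cong (2 *_) (∑-R≡pairCount A) ⟨
  2 * ∑[ n < m ] R A n  ≡⟨ cong (2 *_) (sum-cong-≗ {m} R≗R) ⟩
  2 * ∑[ n < m ] R B n  ≡⟨ cong (2 *_) (∑-R≡pairCount B) ⟩
  2 * pairCount B       ≡⟨ pairCount-triangular B ⟩
  ∣ B ∣ * suc ∣ B ∣     ∎)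
  where open ≡-Reasoning

lemma1 : (k : ℕ) → (A B : Subset (2 * suc k))
    → A ∪ B ≡ ⊤
    → ∣ A ∩ B ∣ ≡ 2
    → ((n : Fin (2 * suc k)) → R A n ≡ R B n)
    → (∣ A ∣ ≡ suc k + 1) × (∣ B ∣ ≡ suc k + 1)
lemma1 k A B A∪B≡⊤ ∣A∩B∣≡2 R≗R = ∣A∣≡k+2 , trans (sym ∣A∣≡∣B∣) ∣A∣≡k+2
  where
  open ≡-Reasoning
  ∣A∣≡∣B∣ : ∣ A ∣ ≡ ∣ B ∣
  ∣A∣≡∣B∣ = R≗R⇒∣∣≡∣∣ A B R≗R
  ∣A∣≡k+2 : ∣ A ∣ ≡ suc k + 1
  ∣A∣≡k+2 = *-cancelˡ-≡ ∣ A ∣ (suc k + 1) 2 (begin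
    2 * ∣ A ∣                  ≡⟨ cong (∣ A ∣ +_) (+-identityʳ ∣ A ∣) ⟩
    ∣ A ∣ + ∣ A ∣              ≡⟨ cong (∣ A ∣ +_) ∣A∣≡∣B∣ ⟩
    ∣ A ∣ + ∣ B ∣              ≡⟨ ∣p∪q∣+∣p∩q∣≡∣p∣+∣q∣ A B ⟨
    ∣ A ∪ B ∣ + ∣ A ∩ B ∣      ≡⟨ cong₂ _+_ (trans (cong ∣_∣ A∪B≡⊤) (∣⊤∣≡n (2 * suc k))) ∣A∩B∣≡2 ⟩
    2 * suc k + 2              ≡⟨ *-distribˡ-+ 2 (suc k) 1 ⟨
    2 * (suc k + 1)            ∎)
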